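{- If $G$ is an edge-regular graph with parameters $(n,k,\lambda)$, then the Gallai graph $\Gamma(G)$ and the anti-Gallai graph $\Delta(G)$ are regular graphs.
   Context: All graphs are finite and simple. An edge-regular graph with parameters $(n,k,\lambda)$ is a $k$-regular graph on $n$ vertices in which any two adjacent vertices have exactly $\lambda$ common neighbours. The Gallai graph $\Gamma(G)$ has the edges of $G$ as vertices, two being adjacent iff the corresponding edges of $G$ share a vertex but do not lie on a common triangle of $G$. The anti-Gallai graph $\Delta(G)$ has the edges of $G$ as vertices, two being adjacent iff the corresponding edges lie on a common triangle of $G$. -}

module Defs where

open import Data.Nat using (ℕ; _<ᵇ_)
open import Data.Bool using (Bool; true; false; _∧_; _∨_; not; if_then_else_)
open import Data.Fin using (Fin; toℕ; _≟_)
open import Data.List using (List; []; _∷_; filter; length; concatMap; map)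
open import Data.Bool.ListAction using (any)
open import Data.List.Membership.Propositional using (_∈_)
open import Data.Product using (_×_; _,_; ∃)
open import Relation.Nullary.Decidable using (⌊_⌋)
open import Relation.Binary.PropositionalEquality using (_≡_)
open import Data.Vec using (allFin; toList)
open import Data.Bool.Properties using (T?)

record Graph (n : ℕ) : Set where
  field
    adj    : Fin n → Fin n → Bool
    sym    : ∀ i j → adj i j ≡ adj j i
    irrefl : ∀ i → adj i i ≡ false
open Graph public

vertices : (n : ℕ) → List (Fin n)
vertices n = toList (allFin n)

countB : {A : Set} → (A → Bool) → List A → ℕ
countB p xs = length (filter (λ x → T? (p x)) xs)

_==_ : {n : ℕ} → Fin n → Fin n → Bool
i == j = ⌊ i ≟ j ⌋

module _ {n : ℕ} (G : Graph n) where

  degree : Fin n → ℕ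
  degree v = countB (adj G v) (vertices n)

  commonNbrs : Fin n → Fin n → ℕ
  commonNbrs u v = countB (λ w → adj G u w ∧ adj G v w) (vertices n)

  -- edge-regular with parameters (n, k, λ)  (n is the number of vertices)
  EdgeRegular : ℕ → ℕ → Set
  EdgeRegular k l =
    (∀ v → degree v ≡ k) ×
    (∀ u v → adj G u v ≡ true → commonNbrs u v ≡ l)

  -- An edge {a,b} is represented by the unique pair (a , b) with a < b.
  Edge : Set
  Edge = Fin n × Fin n

  edges : List Edge
  edges = filter (λ e → T? (isEdge e))
            (concatMap (λ a → map (λ b → (a , b)) (vertices n)) (vertices n))
    where
    isEdge : Edge → Bool
    isEdge (a , b) = (toℕ a <ᵇ toℕ b) ∧ adj G a b

  sameEdge : Edge → Edge → Bool
  sameEdge (a , b) (c , d) = (a == c) ∧ (b == d)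

  shareVertex : Edge → Edge → Bool
  shareVertex (a , b) (c , d) = (a == c) ∨ (a == d) ∨ (b == c) ∨ (b == d)

  inTriple : Fin n → Fin n → Fin n → Fin n → Bool
  inTriple v x y z = (v == x) ∨ (v == y) ∨ (v == z)

  isTriangle : Fin n → Fin n → Fin n → Bool
  isTriangle x y z = adj G x y ∧ adj G y z ∧ adj G x z

  edgeInTriple : Edge → Fin n → Fin n → Fin n → Bool
  edgeInTriple (a , b) x y z = inTriple a x y z ∧ inTriple b x y z

  commonTriangle : Edge → Edge → Bool
  commonTriangle e f =
    any (λ x → any (λ y → any (λ z →
          isTriangle x y z ∧ edgeInTriple e x y z ∧ edgeInTriple f x y z)
        (vertices n)) (vertices n)) (vertices n)

  gallaiAdj : Edge → Edge → Bool
  gallaiAdj e f = not (sameEdge e f) ∧ shareVertex e f ∧ not (commonTriangle e f)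

  antiGallaiAdj : Edge → Edge → Bool
  antiGallaiAdj e f = not (sameEdge e f) ∧ commonTriangle e f

Regular : {V : Set} → List V → (V → V → Bool) → Set
Regular {V} vs A = ∃ λ (r : ℕ) → ∀ (v : V) → v ∈ vs → countB (A v) vs ≡ r

GallaiGraphRegular : {n : ℕ} → Graph n → Set
GallaiGraphRegular G = Regular (edges G) (gallaiAdj G)

AntiGallaiGraphRegular : {n : ℕ} → Graph n → Set
AntiGallaiGraphRegular G = Regular (edges G) (antiGallaiAdj G)

-- Fix an edge ab. Its neighbours in the line graph are the edges aw (w ≠ b) and bw (w ≠ a),
-- 2(k − 1) of them. Two distinct edges on a common triangle share a vertex, so the Gallai and
-- anti-Gallai neighbourhoods of ab split this line-graph neighbourhood. An edge f ≠ ab lies on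
-- a triangle with ab exactly when f = aw or f = bw for a common neighbour w of a and b, so ab
-- has 2λ anti-Gallai neighbours and hence 2(k − 1) − 2λ Gallai neighbours.
module Submission where

open import Algebra.Properties.CommutativeSemigroup using (interchange)
open import Data.Bool using (Bool; true; false; _∧_; _∨_; not; T)
open import Data.Bool.ListAction using (any)
open import Data.Bool.Properties using (T?; T-≡; T-∧; T-∨; ∧-zeroʳ; ∨-identityʳ)
open import Data.Empty using (⊥; ⊥-elim)
open import Data.Fin using (Fin; toℕ; _≟_; _<_; zero; suc)
open import Data.Fin.Properties using (<-irrefl; <-asym; <-cmp; <⇒≢)
open import Data.List using (List; []; _∷_; _++_; filter; map; concatMap; length)
open import Data.List.Membership.Propositional using (_∈_; lose)
open import Data.List.Membership.Propositional.Properties using (∈-filter⁻)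
open import Data.List.Properties using (filter-++; length-++)
open import Data.List.Relation.Unary.Any using (here; there; satisfied)
open import Data.List.Relation.Unary.Any.Properties using (any⁺; any⁻)
open import Data.Nat using (ℕ; _+_; _∸_; _<ᵇ_)
open import Data.Nat.Properties
  using (+-0-commutativeMonoid; +-commutativeSemigroup; +-identityʳ; m+n∸n≡m; _<?_; <ᵇ⇒<)
open import Data.Product using (_×_; _,_; proj₁; proj₂; ∃-syntax; map₁; map₂; uncurry)
import Data.Product as Product
open import Data.Sum using (_⊎_; inj₁; inj₂)
import Data.Sum as Sum
open import Data.Vec using (tabulate; toList)
open import Data.Vec.Membership.Propositional.Properties using (∈-toList⁺; ∈-allFin⁺)
open import Function using (_∘_; Equivalence)
open import Relation.Binary.Definitions using (tri<; tri≈; tri>)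
open import Relation.Binary.PropositionalEquality
open import Relation.Nullary using (¬_; yes; no)
open import Relation.Nullary.Decidable using (dec-true; dec-false; toWitness; fromWitness)
open import Relation.Unary using (_⊆_)

open import Algebra.Properties.CommutativeMonoid.Sum +-0-commutativeMonoid
  using (sum-syntax; ∑-distrib-+; ∑-comm; sum-cong-≗; sum-replicate-zero)

open import Defs hiding (sym)

open Equivalence using (to; from)

private
  variable
    A B : Set

⟦_⟧ : Bool → ℕ
⟦ true  ⟧ = 1
⟦ false ⟧ = 0

T-ext : {x y : Bool} → (T x → T y) → (T y → T x) → x ≡ y
T-ext {true}  {true}  _ _ = refl
T-ext {true}  {false} f _ = ⊥-elim (f _)
T-ext {false} {true}  _ g = ⊥-elim (g _)
T-ext {false} {false} _ _ = refl

T-not : {x : Bool} → ¬ T x → T (not x)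
T-not {true}  h = h _
T-not {false} _ = _

T-not⁻ : {x : Bool} → T (not x) → ¬ T x
T-not⁻ {false} _ ()

∧-absorbˡ : ∀ x y → x ∧ (x ∧ y) ≡ x ∧ y
∧-absorbˡ true  _ = refl
∧-absorbˡ false _ = refl

∧-absorbʳ : ∀ x y → y ∧ (x ∧ y) ≡ x ∧ y
∧-absorbʳ x true  = refl
∧-absorbʳ x false = sym (∧-zeroʳ x)

⟦∧⟧-split : ∀ x y z → (T (x ∧ z) → T y) → ⟦ x ∧ y ∧ not z ⟧ + ⟦ x ∧ z ⟧ ≡ ⟦ x ∧ y ⟧
⟦∧⟧-split false _     _     _ = refl
⟦∧⟧-split true  true  true  _ = refl
⟦∧⟧-split true  true  false _ = refl
⟦∧⟧-split true  false true  h = ⊥-elim (h _)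
⟦∧⟧-split true  false false _ = refl

countB-∷ : (p : A → Bool) (x : A) (xs : List A) → countB p (x ∷ xs) ≡ ⟦ p x ⟧ + countB p xs
countB-∷ p x xs with p x
... | true  = refl
... | false = refl

countB-++ : (p : A → Bool) (xs ys : List A) → countB p (xs ++ ys) ≡ countB p xs + countB p ys
countB-++ p xs ys = trans (cong length (filter-++ (T? ∘ p) xs ys)) (length-++ (filter (T? ∘ p) xs))

countB-map : (p : B → Bool) (f : A → B) (xs : List A) → countB p (map f xs) ≡ countB (p ∘ f) xs
countB-map p f []       = refl
countB-map p f (x ∷ xs) =
  trans (countB-∷ p (f x) _) (trans (cong (⟦ p (f x) ⟧ +_) (countB-map p f xs)) (sym (countB-∷ (p ∘ f) x xs)))

countB-filter-∷ : (p q : A → Bool) (x : A) (xs : List A) →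
                  countB p (filter (T? ∘ q) (x ∷ xs)) ≡ ⟦ q x ∧ p x ⟧ + countB p (filter (T? ∘ q) xs)
countB-filter-∷ p q x xs with q x
... | true  = countB-∷ p x _
... | false = refl

countB-filter : (p q : A → Bool) (xs : List A) → countB p (filter (T? ∘ q) xs) ≡ countB (λ x → q x ∧ p x) xs
countB-filter p q []       = refl
countB-filter p q (x ∷ xs) =
  trans (countB-filter-∷ p q x xs)
    (trans (cong (⟦ q x ∧ p x ⟧ +_) (countB-filter p q xs)) (sym (countB-∷ (λ y → q y ∧ p y) x xs)))

countB-cong : (p q : A → Bool) (xs : List A) → (∀ x → x ∈ xs → p x ≡ q x) → countB p xs ≡ countB q xs
countB-cong p q []       _ = refl
countB-cong p q (x ∷ xs) h = begin
  countB p (x ∷ xs)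
    ≡⟨ countB-∷ p x xs ⟩
  ⟦ p x ⟧ + countB p xs
    ≡⟨ cong₂ _+_ (cong ⟦_⟧ (h x (here refl))) (countB-cong p q xs (λ y → h y ∘ there)) ⟩
  ⟦ q x ⟧ + countB q xs
    ≡⟨ countB-∷ q x xs ⟨
  countB q (x ∷ xs)
    ∎
  where open ≡-Reasoning

countB-+ : (p q r : A → Bool) (xs : List A) → (∀ x → x ∈ xs → ⟦ p x ⟧ + ⟦ q x ⟧ ≡ ⟦ r x ⟧) →
           countB p xs + countB q xs ≡ countB r xs
countB-+ p q r []       _ = refl
countB-+ p q r (x ∷ xs) h = begin
  countB p (x ∷ xs) + countB q (x ∷ xs)
    ≡⟨ cong₂ _+_ (countB-∷ p x xs) (countB-∷ q x xs) ⟩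
  (⟦ p x ⟧ + countB p xs) + (⟦ q x ⟧ + countB q xs)
    ≡⟨ interchange +-commutativeSemigroup ⟦ p x ⟧ (countB p xs) ⟦ q x ⟧ (countB q xs) ⟩
  (⟦ p x ⟧ + ⟦ q x ⟧) + (countB p xs + countB q xs)
    ≡⟨ cong₂ _+_ (h x (here refl)) (countB-+ p q r xs (λ y → h y ∘ there)) ⟩
  ⟦ r x ⟧ + countB r xs
    ≡⟨ countB-∷ r x xs ⟨
  countB r (x ∷ xs)
    ∎
  where open ≡-Reasoning

countB-∨ : (p q : A → Bool) (xs : List A) → (∀ x → x ∈ xs → T (p x) → ¬ T (q x)) →
           countB p xs + countB q xs ≡ countB (λ x → p x ∨ q x) xs
countB-∨ p q xs disjoint = countB-+ p q _ xs (λ x x∈ → ⟦∨⟧ (p x) (q x) (disjoint x x∈))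
  where
  ⟦∨⟧ : ∀ u v → (T u → ¬ T v) → ⟦ u ⟧ + ⟦ v ⟧ ≡ ⟦ u ∨ v ⟧
  ⟦∨⟧ true  true  h = ⊥-elim (h _ _)
  ⟦∨⟧ true  false _ = refl
  ⟦∨⟧ false _     _ = refl

countB-tabulate : ∀ {m} (p : A → Bool) (f : Fin m → A) →
                  countB p (toList (tabulate f)) ≡ ∑[ i < m ] ⟦ p (f i) ⟧
countB-tabulate {m = ℕ.zero}  p f = refl
countB-tabulate {m = ℕ.suc m} p f =
  trans (countB-∷ p (f zero) _) (cong (⟦ p (f zero) ⟧ +_) (countB-tabulate p (f ∘ suc)))

countB-concatMap-tabulate : ∀ {m} (p : A → Bool) (h : B → List A) (f : Fin m → B) →
  countB p (concatMap h (toList (tabulate f))) ≡ ∑[ i < m ] countB p (h (f i))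
countB-concatMap-tabulate {m = ℕ.zero}  p h f = refl
countB-concatMap-tabulate {m = ℕ.suc m} p h f =
  trans (countB-++ p (h (f zero)) _) (cong (countB p (h (f zero)) +_) (countB-concatMap-tabulate p h (f ∘ suc)))

countB-vertices : ∀ {n} (p : Fin n → Bool) → countB p (vertices n) ≡ ∑[ i < n ] ⟦ p i ⟧
countB-vertices p = countB-tabulate p (λ i → i)

∈-vertices : ∀ {n} (v : Fin n) → v ∈ vertices n
∈-vertices v = ∈-toList⁺ (∈-allFin⁺ v)

==⇒≡ : ∀ {n} {x y : Fin n} → T (x == y) → x ≡ y
==⇒≡ = toWitness

≡⇒== : ∀ {n} {x y : Fin n} → x ≡ y → T (x == y)
≡⇒== = fromWitness

-- Needed because ⌊_⌋ only computes on a Dec in constructor form.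
==-suc : ∀ {n} (v c : Fin n) → (suc v == suc c) ≡ (v == c)
==-suc v c with v ≟ c
... | yes _ = refl
... | no  _ = refl

_≠_ : ∀ {n} → Fin n → Fin n → Bool
x ≠ y = not (x == y)

≢⇒≠ : ∀ {n} {x y : Fin n} → x ≢ y → T (x ≠ y)
≢⇒≠ x≢y = T-not (x≢y ∘ ==⇒≡)

≠-irrefl : ∀ {n} {x : Fin n} → ¬ T (x ≠ x)
≠-irrefl x≠x = T-not⁻ x≠x (≡⇒== refl)

∑-select : ∀ {n} (v : Fin n) (q : Fin n → Bool) → ∑[ c < n ] ⟦ v == c ∧ q c ⟧ ≡ ⟦ q v ⟧
∑-select {ℕ.suc n} zero    q = trans (cong (⟦ q zero ⟧ +_) (sum-replicate-zero n)) (+-identityʳ _)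
∑-select {ℕ.suc n} (suc v) q =
  trans (sum-cong-≗ (λ c → cong (λ b → ⟦ b ∧ q (suc c) ⟧) (==-suc v c))) (∑-select v (q ∘ suc))

<ᵇ-true : ∀ {n} {i j : Fin n} → i < j → (toℕ i <ᵇ toℕ j) ≡ true
<ᵇ-true {i = i} {j} = dec-true (toℕ i <? toℕ j)

<ᵇ-false : ∀ {n} {i j : Fin n} → ¬ i < j → (toℕ i <ᵇ toℕ j) ≡ false
<ᵇ-false {i = i} {j} = dec-false (toℕ i <? toℕ j)

<ᵇ-irrefl : ∀ {n} (i : Fin n) → (toℕ i <ᵇ toℕ i) ≡ false
<ᵇ-irrefl i = <ᵇ-false {i = i} (<-irrefl refl)

joins : ∀ {n} → Fin n → (Fin n → Bool) → Fin n × Fin n → Bool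
joins v P (c , d) = (v == c ∧ P d) ∨ (v == d ∧ P c)

module _ {n : ℕ} (P : Fin n → Bool) (v c d : Fin n) where

  joins⁻ : T (joins v P (c , d)) → (v ≡ c × T (P d)) ⊎ (v ≡ d × T (P c))
  joins⁻ = Sum.map (map₁ ==⇒≡ ∘ to (T-∧ {v == c})) (map₁ ==⇒≡ ∘ to (T-∧ {v == d}))
         ∘ to (T-∨ {v == c ∧ P d})

  joins⁺ : (v ≡ c × T (P d)) ⊎ (v ≡ d × T (P c)) → T (joins v P (c , d))
  joins⁺ = from (T-∨ {v == c ∧ P d})
         ∘ Sum.map (from (T-∧ {v == c}) ∘ map₁ ≡⇒==) (from (T-∧ {v == d}) ∘ map₁ ≡⇒==)

joins-mono : ∀ {n} (P Q : Fin n → Bool) → (∀ {w} → T (P w) → T (Q w)) →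
             ∀ v c d → T (joins v P (c , d)) → T (joins v Q (c , d))
joins-mono P Q P⇒Q v c d = joins⁺ Q v c d ∘ Sum.map (map₂ P⇒Q) (map₂ P⇒Q) ∘ joins⁻ P v c d

joins-disjoint : ∀ {n} (P Q : Fin n → Bool) {a b : Fin n} → a ≢ b → ¬ T (P b) → ¬ T (Q a) →
                 ∀ c d → T (joins a P (c , d)) → ¬ T (joins b Q (c , d))
joins-disjoint P Q {a} {b} a≢b ¬Pb ¬Qa c d ja jb with joins⁻ P a c d ja | joins⁻ Q b c d jb
... | inj₁ (refl , _)  | inj₁ (refl , _)  = a≢b refl
... | inj₁ (refl , _)  | inj₂ (refl , Qc) = ¬Qa Qc
... | inj₂ (refl , Pc) | inj₁ (refl , _)  = ¬Pb Pc
... | inj₂ (refl , _)  | inj₂ (refl , _)  = a≢b refl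

data OneOf (x y z : A) : A → Set where
  first  : OneOf x y z x
  second : OneOf x y z y
  third  : OneOf x y z z

module _ {n : ℕ} (G : Graph n) where

  isEdge : Fin n × Fin n → Bool
  isEdge (c , d) = (toℕ c <ᵇ toℕ d) ∧ adj G c d

  vertexPairs : List (Fin n × Fin n)
  vertexPairs = concatMap (λ c → map (c ,_) (vertices n)) (vertices n)

  isCommonNbr : Fin n → Fin n → Fin n → Bool
  isCommonNbr a b w = adj G a w ∧ adj G b w

  lineGraphAdj : Fin n × Fin n → Fin n × Fin n → Bool
  lineGraphAdj e f = not (sameEdge G e f) ∧ shareVertex G e f

  adj-sym : ∀ {x y} → T (adj G x y) → T (adj G y x)
  adj-sym {x} {y} = subst T (Graph.sym G x y)

  adj-irrefl : ∀ {x} → ¬ T (adj G x x)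
  adj-irrefl {x} = subst T (irrefl G x)

  ∈-edges⁻ : ∀ {c d} → (c , d) ∈ edges G → c < d × T (adj G c d)
  ∈-edges⁻ {c} {d} f∈ =
    map₁ (<ᵇ⇒< (toℕ c) (toℕ d))
      (to (T-∧ {toℕ c <ᵇ toℕ d} {adj G c d}) (proj₂ (∈-filter⁻ (T? ∘ isEdge) {xs = vertexPairs} f∈)))

  ∈-edges⇒< : ∀ {c d} → (c , d) ∈ edges G → c < d
  ∈-edges⇒< = proj₁ ∘ ∈-edges⁻

  countB-edges : (p : Fin n × Fin n → Bool) →
                 countB p (edges G) ≡ ∑[ c < n ] ∑[ d < n ] ⟦ isEdge (c , d) ∧ p (c , d) ⟧
  countB-edges p = begin
      countB p (edges G)
    ≡⟨ countB-filter p isEdge vertexPairs ⟩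
      countB (λ e → isEdge e ∧ p e) vertexPairs
    ≡⟨ countB-concatMap-tabulate (λ e → isEdge e ∧ p e) (λ c → map (c ,_) (vertices n)) (λ c → c) ⟩
      ∑[ c < n ] countB (λ e → isEdge e ∧ p e) (map (c ,_) (vertices n))
    ≡⟨ sum-cong-≗ (λ c → trans (countB-map (λ e → isEdge e ∧ p e) (c ,_) (vertices n))
                                (countB-vertices (λ d → isEdge (c , d) ∧ p (c , d)))) ⟩
      ∑[ c < n ] ∑[ d < n ] ⟦ isEdge (c , d) ∧ p (c , d) ⟧
    ∎
    where open ≡-Reasoning

  isEdge∧joins : ∀ v P c d → ⟦ isEdge (c , d) ∧ joins v P (c , d) ⟧ ≡
                             ⟦ v == c ∧ (isEdge (v , d) ∧ P d) ⟧ + ⟦ v == d ∧ (isEdge (c , v) ∧ P c) ⟧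
  isEdge∧joins v P c d with v ≟ c | v ≟ d
  ... | yes refl | yes refl rewrite <ᵇ-irrefl v = refl
  ... | yes refl | no _     =
    trans (cong (λ b → ⟦ isEdge (v , d) ∧ b ⟧) (∨-identityʳ (P d))) (sym (+-identityʳ _))
  ... | no _     | yes refl = refl
  ... | no _     | no _     = cong ⟦_⟧ (∧-zeroʳ (isEdge (c , d)))

  isEdge-either : ∀ (P : Fin n → Bool) v w →
                  ⟦ isEdge (v , w) ∧ P w ⟧ + ⟦ isEdge (w , v) ∧ P w ⟧ ≡ ⟦ adj G v w ∧ P w ⟧
  isEdge-either P v w with <-cmp v w
  ... | tri< v<w _ w≮v rewrite <ᵇ-true v<w | <ᵇ-false w≮v = +-identityʳ _
  ... | tri> v≮w _ w<v rewrite <ᵇ-false v≮w | <ᵇ-true w<v = cong (λ b → ⟦ b ∧ P w ⟧) (Graph.sym G w v)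
  ... | tri≈ _ refl _ rewrite <ᵇ-irrefl v | irrefl G v = refl

  countB-joins : ∀ v P → countB (joins v P) (edges G) ≡ countB (λ w → adj G v w ∧ P w) (vertices n)
  countB-joins v P = begin
      countB (joins v P) (edges G)
    ≡⟨ countB-edges (joins v P) ⟩
      ∑[ c < n ] ∑[ d < n ] ⟦ isEdge (c , d) ∧ joins v P (c , d) ⟧
    ≡⟨ sum-cong-≗ (λ c → trans (sum-cong-≗ (isEdge∧joins v P c)) (∑-distrib-+ (out c) (into c))) ⟩
      ∑[ c < n ] (∑[ d < n ] out c d + ∑[ d < n ] into c d)
    ≡⟨ ∑-distrib-+ (λ c → ∑[ d < n ] out c d) (λ c → ∑[ d < n ] into c d) ⟩
      ∑[ c < n ] ∑[ d < n ] out c d + ∑[ c < n ] ∑[ d < n ] into c d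
    ≡⟨ cong₂ _+_ (trans (∑-comm out) (sum-cong-≗ (λ d → ∑-select v (λ _ → isEdge (v , d) ∧ P d))))
                 (sum-cong-≗ (λ c → ∑-select v (λ _ → isEdge (c , v) ∧ P c))) ⟩
      ∑[ w < n ] ⟦ isEdge (v , w) ∧ P w ⟧ + ∑[ w < n ] ⟦ isEdge (w , v) ∧ P w ⟧
    ≡⟨ trans (sym (∑-distrib-+ (λ w → ⟦ isEdge (v , w) ∧ P w ⟧) (λ w → ⟦ isEdge (w , v) ∧ P w ⟧)))
             (sum-cong-≗ (isEdge-either P v)) ⟩
      ∑[ w < n ] ⟦ adj G v w ∧ P w ⟧
    ≡⟨ countB-vertices (λ w → adj G v w ∧ P w) ⟨
      countB (λ w → adj G v w ∧ P w) (vertices n)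
    ∎
    where
    open ≡-Reasoning
    out into : Fin n → Fin n → ℕ
    out  c d = ⟦ v == c ∧ (isEdge (v , d) ∧ P d) ⟧
    into c d = ⟦ v == d ∧ (isEdge (c , v) ∧ P c) ⟧

  inTriple⁻ : ∀ {v x y z} → T (inTriple G v x y z) → OneOf x y z v
  inTriple⁻ {v} {x} {y} {z} h with v ≟ x | v ≟ y | v ≟ z
  ... | yes refl | _        | _        = first
  ... | no _     | yes refl | _        = second
  ... | no _     | no _     | yes refl = third
  ... | no _     | no _     | no _     = ⊥-elim h

  inTriple⁺ : ∀ {v x y z} → OneOf x y z v → T (inTriple G v x y z)
  inTriple⁺ {v} {x} {y} {z} first  = from (T-∨ {v == x}) (inj₁ (≡⇒== refl))
  inTriple⁺ {v} {x} {y} {z} second = from (T-∨ {v == x}) (inj₂ (from (T-∨ {v == y}) (inj₁ (≡⇒== refl))))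
  inTriple⁺ {v} {x} {y} {z} third  = from (T-∨ {v == x}) (inj₂ (from (T-∨ {v == y}) (inj₂ (≡⇒== refl))))

  edgeInTriple⁻ : ∀ {x y z} a b → T (edgeInTriple G (a , b) x y z) → OneOf x y z a × OneOf x y z b
  edgeInTriple⁻ {x} {y} {z} a b = Product.map inTriple⁻ inTriple⁻ ∘ to (T-∧ {inTriple G a x y z})

  edgeInTriple⁺ : ∀ {x y z} a b → OneOf x y z a → OneOf x y z b → T (edgeInTriple G (a , b) x y z)
  edgeInTriple⁺ {x} {y} {z} a b a∈ b∈ = from (T-∧ {inTriple G a x y z}) (inTriple⁺ a∈ , inTriple⁺ b∈)

  triangle-through : ∀ {x y z u v} → T (isTriangle G x y z) → OneOf x y z u → OneOf x y z v → u ≢ v →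
                     ∃[ t ] T (adj G u t) × T (adj G v t) × OneOf x y z ⊆ OneOf u v t
  triangle-through {x} {y} {z} tri = through
    where
    xy : T (adj G x y)
    xy = proj₁ (to (T-∧ {adj G x y}) tri)
    yz : T (adj G y z)
    yz = proj₁ (to (T-∧ {adj G y z}) (proj₂ (to (T-∧ {adj G x y}) tri)))
    xz : T (adj G x z)
    xz = proj₂ (to (T-∧ {adj G y z}) (proj₂ (to (T-∧ {adj G x y}) tri)))

    through : ∀ {u v} → OneOf x y z u → OneOf x y z v → u ≢ v →
              ∃[ t ] T (adj G u t) × T (adj G v t) × OneOf x y z ⊆ OneOf u v t
    through first  first  u≢v = ⊥-elim (u≢v refl)
    through second second u≢v = ⊥-elim (u≢v refl)
    through third  third  u≢v = ⊥-elim (u≢v refl)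
    through first  second _ = z , xz , yz , λ { first → first ; second → second ; third → third }
    through second first  _ = z , yz , xz , λ { first → second ; second → first ; third → third }
    through first  third  _ = y , xy , adj-sym yz , λ { first → first ; second → third ; third → second }
    through third  first  _ = y , adj-sym yz , xy , λ { first → second ; second → third ; third → first }
    through second third  _ = x , adj-sym xy , adj-sym xz , λ { first → third ; second → first ; third → second }
    through third  second _ = x , adj-sym xz , adj-sym xy , λ { first → third ; second → second ; third → first }

  onCommonTriangle : Fin n × Fin n → Fin n × Fin n → Fin n → Fin n → Fin n → Bool
  onCommonTriangle e f x y z = isTriangle G x y z ∧ edgeInTriple G e x y z ∧ edgeInTriple G f x y z

  commonTriangle⁻ : ∀ a b c d → T (commonTriangle G (a , b) (c , d)) →
    ∃[ x ] ∃[ y ] ∃[ z ] T (isTriangle G x y z) ×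
      OneOf x y z a × OneOf x y z b × OneOf x y z c × OneOf x y z d
  commonTriangle⁻ a b c d h =
    let on = onCommonTriangle (a , b) (c , d)
        x , hx = satisfied (any⁻ (λ x → any (λ y → any (on x y) (vertices n)) (vertices n)) (vertices n) h)
        y , hy = satisfied (any⁻ (λ y → any (on x y) (vertices n)) (vertices n) hx)
        z , hz = satisfied (any⁻ (on x y) (vertices n) hy)
        tri , onTri = to (T-∧ {isTriangle G x y z}) hz
        ab , cd = to (T-∧ {edgeInTriple G (a , b) x y z}) onTri
        a∈ , b∈ = edgeInTriple⁻ a b ab
        c∈ , d∈ = edgeInTriple⁻ c d cd
    in x , y , z , tri , a∈ , b∈ , c∈ , d∈

  commonTriangle⁺ : ∀ {x y z} a b c d → T (isTriangle G x y z) →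
    OneOf x y z a → OneOf x y z b → OneOf x y z c → OneOf x y z d → T (commonTriangle G (a , b) (c , d))
  commonTriangle⁺ {x} {y} {z} a b c d tri a∈ b∈ c∈ d∈ =
    any⁺ _ (lose (∈-vertices x) (any⁺ _ (lose (∈-vertices y) (any⁺ _ (lose (∈-vertices z)
      (from (T-∧ {isTriangle G x y z}) (tri , from (T-∧ {edgeInTriple G (a , b) x y z})
        (edgeInTriple⁺ a b a∈ b∈ , edgeInTriple⁺ c d c∈ d∈))))))))

  sameEdge⁻ : ∀ {a b c d} → T (sameEdge G (a , b) (c , d)) → a ≡ c × b ≡ d
  sameEdge⁻ {a} {b} {c} {d} = Product.map ==⇒≡ ==⇒≡ ∘ to (T-∧ {a == c})

  sameEdge⁺ : ∀ {a b c d} → a ≡ c × b ≡ d → T (sameEdge G (a , b) (c , d))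
  sameEdge⁺ {a} {b} {c} {d} = from (T-∧ {a == c}) ∘ Product.map ≡⇒== ≡⇒==

  commonNbr-≢ : ∀ {a b w} → T (isCommonNbr a b w) → a ≢ w × b ≢ w
  commonNbr-≢ {a} {b} {w} h =
      (λ a≡w → adj-irrefl (subst (λ v → T (adj G v w)) a≡w (proj₁ aw×bw)))
    , (λ b≡w → adj-irrefl (subst (λ v → T (adj G v w)) b≡w (proj₂ aw×bw)))
    where
    aw×bw : T (adj G a w) × T (adj G b w)
    aw×bw = to (T-∧ {adj G a w}) h

  commonNbr-endpoint : ∀ {a b c d w} → T (isCommonNbr a b w) → w ≡ c ⊎ w ≡ d → ¬ (a ≡ c × b ≡ d)
  commonNbr-endpoint Cw (inj₁ w≡c) (a≡c , _) = proj₁ (commonNbr-≢ Cw) (trans a≡c (sym w≡c))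
  commonNbr-endpoint Cw (inj₂ w≡d) (_ , b≡d) = proj₂ (commonNbr-≢ Cw) (trans b≡d (sym w≡d))

  -- A truth table in a = c, a = d, b = c, b = d; the missing rows contradict a < b or c < d.
  lineGraphAdj-joins : ∀ {a b c d} → a < b → c < d →
    lineGraphAdj (a , b) (c , d) ≡ joins a (b ≠_) (c , d) ∨ joins b (a ≠_) (c , d)
  lineGraphAdj-joins {a} {b} {c} {d} a<b c<d with a ≟ c | a ≟ d | b ≟ c | b ≟ d
  ... | yes refl | yes refl | _        | _        = ⊥-elim (<-irrefl refl c<d)
  ... | yes refl | no _     | yes refl | _        = ⊥-elim (<-irrefl refl a<b)
  ... | yes refl | no _     | no _     | yes refl = refl
  ... | yes refl | no _     | no _     | no _     = refl
  ... | no _     | yes refl | yes refl | _        = ⊥-elim (<-asym a<b c<d)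
  ... | no _     | yes refl | no _     | yes refl = ⊥-elim (<-irrefl refl a<b)
  ... | no _     | yes refl | no _     | no _     = refl
  ... | no _     | no _     | yes refl | yes refl = ⊥-elim (<-irrefl refl c<d)
  ... | no _     | no _     | yes refl | no _     = refl
  ... | no _     | no _     | no _     | yes refl = refl
  ... | no _     | no _     | no _     | no _     = refl

  joinsEither : Fin n → Fin n → (Fin n → Bool) → Fin n × Fin n → Bool
  joinsEither a b P f = joins a P f ∨ joins b P f

  joinsEither-commonNbr : ∀ a b c d → T (joinsEither a b (isCommonNbr a b) (c , d)) →
    ∃[ w ] T (isCommonNbr a b w) × (w ≡ c ⊎ w ≡ d) × OneOf a b w c × OneOf a b w d
  joinsEither-commonNbr a b c d h with to (T-∨ {joins a (isCommonNbr a b) (c , d)}) h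
  ... | inj₁ ja with joins⁻ (isCommonNbr a b) a c d ja
  ...   | inj₁ (refl , Cd) = d , Cd , inj₂ refl , first , third
  ...   | inj₂ (refl , Cc) = c , Cc , inj₁ refl , third , first
  joinsEither-commonNbr a b c d h | inj₂ jb with joins⁻ (isCommonNbr a b) b c d jb
  ...   | inj₁ (refl , Cd) = d , Cd , inj₂ refl , second , third
  ...   | inj₂ (refl , Cc) = c , Cc , inj₁ refl , third , second

  joinsEither⁺ : (P : Fin n → Bool) → ∀ a b c d →
                 T (joins a P (c , d)) ⊎ T (joins b P (c , d)) → T (joinsEither a b P (c , d))
  joinsEither⁺ P a b c d = from (T-∨ {joins a P (c , d)})

  edge⊆abt⇒joinsEither : ∀ {a b c d t} → a < b → c < d → T (isCommonNbr a b t) → ¬ (a ≡ c × b ≡ d) →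
                         OneOf a b t c → OneOf a b t d → T (joinsEither a b (isCommonNbr a b) (c , d))
  edge⊆abt⇒joinsEither _   c<d _ _ first  first  = ⊥-elim (<-irrefl refl c<d)
  edge⊆abt⇒joinsEither _   _   _ ≢ first  second = ⊥-elim (≢ (refl , refl))
  edge⊆abt⇒joinsEither a<b c<d _ _ second first  = ⊥-elim (<-asym a<b c<d)
  edge⊆abt⇒joinsEither _   c<d _ _ second second = ⊥-elim (<-irrefl refl c<d)
  edge⊆abt⇒joinsEither _   c<d _ _ third  third  = ⊥-elim (<-irrefl refl c<d)
  edge⊆abt⇒joinsEither {a} {b} {t = t} _ _ Ct _ first third =
    joinsEither⁺ (isCommonNbr a b) a b a t (inj₁ (joins⁺ (isCommonNbr a b) a a t (inj₁ (refl , Ct))))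
  edge⊆abt⇒joinsEither {a} {b} {t = t} _ _ Ct _ third first =
    joinsEither⁺ (isCommonNbr a b) a b t a (inj₁ (joins⁺ (isCommonNbr a b) a t a (inj₂ (refl , Ct))))
  edge⊆abt⇒joinsEither {a} {b} {t = t} _ _ Ct _ second third =
    joinsEither⁺ (isCommonNbr a b) a b b t (inj₂ (joins⁺ (isCommonNbr a b) b b t (inj₁ (refl , Ct))))
  edge⊆abt⇒joinsEither {a} {b} {t = t} _ _ Ct _ third second =
    joinsEither⁺ (isCommonNbr a b) a b t b (inj₂ (joins⁺ (isCommonNbr a b) b t b (inj₂ (refl , Ct))))

  antiGallai⇒joinsEither : ∀ {a b c d} → a < b → c < d →
    T (antiGallaiAdj G (a , b) (c , d)) → T (joinsEither a b (isCommonNbr a b) (c , d))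
  antiGallai⇒joinsEither {a} {b} {c} {d} a<b c<d h =
    let notSame , onTriangle = to (T-∧ {not (sameEdge G (a , b) (c , d))} {commonTriangle G (a , b) (c , d)}) h
        _ , _ , _ , tri , a∈ , b∈ , c∈ , d∈ = commonTriangle⁻ a b c d onTriangle
        t , at , bt , ⊆abt = triangle-through tri a∈ b∈ (<⇒≢ a<b)
    in edge⊆abt⇒joinsEither a<b c<d (from (T-∧ {adj G a t}) (at , bt)) (T-not⁻ notSame ∘ sameEdge⁺)
         (⊆abt c∈) (⊆abt d∈)

  joinsEither⇒antiGallai : ∀ {a b c d} → T (adj G a b) →
    T (joinsEither a b (isCommonNbr a b) (c , d)) → T (antiGallaiAdj G (a , b) (c , d))
  joinsEither⇒antiGallai {a} {b} {c} {d} ab h =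
    let w , Cw , w∈cd , c∈ , d∈ = joinsEither-commonNbr a b c d h
        aw , bw = to (T-∧ {adj G a w}) Cw
        abw = from (T-∧ {adj G a b} {adj G b w ∧ adj G a w}) (ab , from (T-∧ {adj G b w}) (bw , aw))
    in from (T-∧ {not (sameEdge G (a , b) (c , d))} {commonTriangle G (a , b) (c , d)})
         (T-not (commonNbr-endpoint Cw w∈cd ∘ sameEdge⁻) , commonTriangle⁺ a b c d abw first second c∈ d∈)

  antiGallaiAdj-joinsEither : ∀ {a b c d} → a < b → T (adj G a b) → c < d →
    antiGallaiAdj G (a , b) (c , d) ≡ joinsEither a b (isCommonNbr a b) (c , d)
  antiGallaiAdj-joinsEither a<b ab c<d = T-ext (antiGallai⇒joinsEither a<b c<d) (joinsEither⇒antiGallai ab)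

  antiGallai⇒lineGraph : ∀ {a b c d} → a < b → T (adj G a b) → c < d →
    T (antiGallaiAdj G (a , b) (c , d)) → T (lineGraphAdj (a , b) (c , d))
  antiGallai⇒lineGraph {a} {b} {c} {d} a<b ab c<d =
    subst T (sym (lineGraphAdj-joins a<b c<d))
      ∘ from (T-∨ {joins a (b ≠_) (c , d)})
      ∘ Sum.map (joins-mono C (b ≠_) (≢⇒≠ ∘ proj₂ ∘ commonNbr-≢) a c d)
                (joins-mono C (a ≠_) (≢⇒≠ ∘ proj₁ ∘ commonNbr-≢) b c d)
      ∘ to (T-∨ {joins a C (c , d)})
      ∘ subst T (antiGallaiAdj-joinsEither a<b ab c<d)
    where
    C : Fin n → Bool
    C = isCommonNbr a b

module _ {n k l : ℕ} (G : Graph n) (er : EdgeRegular G k l) where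

  countB-adj-except : ∀ {u v} → T (adj G u v) → countB (λ w → adj G u w ∧ v ≠ w) (vertices n) ≡ k ∸ 1
  countB-adj-except {u} {v} uv = begin
      X
    ≡⟨ m+n∸n≡m X 1 ⟨
      X + 1 ∸ 1
    ≡⟨ cong (λ m → X + m ∸ 1) onlyV ⟨
      X + countB (λ w → v == w ∧ adj G u w) (vertices n) ∸ 1
    ≡⟨ cong (_∸ 1) (countB-+ (λ w → adj G u w ∧ v ≠ w) (λ w → v == w ∧ adj G u w) (adj G u) (vertices n)
                              (λ w _ → complement (adj G u w) (v == w))) ⟩
      degree G u ∸ 1
    ≡⟨ cong (_∸ 1) (proj₁ er u) ⟩
      k ∸ 1
    ∎
    where
    open ≡-Reasoning
    X : ℕ
    X = countB (λ w → adj G u w ∧ v ≠ w) (vertices n)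
    onlyV : countB (λ w → v == w ∧ adj G u w) (vertices n) ≡ 1
    onlyV = trans (countB-vertices (λ w → v == w ∧ adj G u w))
                  (trans (∑-select v (adj G u)) (cong ⟦_⟧ (to (T-≡ {adj G u v}) uv)))
    complement : ∀ x y → ⟦ x ∧ not y ⟧ + ⟦ y ∧ x ⟧ ≡ ⟦ x ⟧
    complement true  true  = refl
    complement true  false = refl
    complement false true  = refl
    complement false false = refl

  module _ {a b : Fin n} (a<b : a < b) (ab : T (adj G a b)) where

    lineGraph-degree : countB (lineGraphAdj G (a , b)) (edges G) ≡ (k ∸ 1) + (k ∸ 1)
    lineGraph-degree = begin
        countB (lineGraphAdj G (a , b)) (edges G)
      ≡⟨ countB-cong _ _ (edges G) (λ { (c , d) f∈ → lineGraphAdj-joins G a<b (∈-edges⇒< G f∈) }) ⟩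
        countB (λ f → joins a (b ≠_) f ∨ joins b (a ≠_) f) (edges G)
      ≡⟨ countB-∨ (joins a (b ≠_)) (joins b (a ≠_)) (edges G)
           (λ { (c , d) _ → joins-disjoint (b ≠_) (a ≠_) (<⇒≢ a<b) ≠-irrefl ≠-irrefl c d }) ⟨
        countB (joins a (b ≠_)) (edges G) + countB (joins b (a ≠_)) (edges G)
      ≡⟨ cong₂ _+_ (trans (countB-joins G a (b ≠_)) (countB-adj-except ab))
                   (trans (countB-joins G b (a ≠_)) (countB-adj-except (adj-sym G ab))) ⟩
        (k ∸ 1) + (k ∸ 1)
      ∎
      where open ≡-Reasoning

    antiGallai-degree : countB (antiGallaiAdj G (a , b)) (edges G) ≡ l + l
    antiGallai-degree = begin
        countB (antiGallaiAdj G (a , b)) (edges G)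
      ≡⟨ countB-cong _ _ (edges G) (λ { (c , d) f∈ → antiGallaiAdj-joinsEither G a<b ab (∈-edges⇒< G f∈) }) ⟩
        countB (joinsEither G a b C) (edges G)
      ≡⟨ countB-∨ (joins a C) (joins b C) (edges G)
           (λ { (c , d) _ → joins-disjoint C C (<⇒≢ a<b) (λ Cb → proj₂ (commonNbr-≢ G Cb) refl)
                                              (λ Ca → proj₁ (commonNbr-≢ G Ca) refl) c d }) ⟨
        countB (joins a C) (edges G) + countB (joins b C) (edges G)
      ≡⟨ cong₂ _+_ (trans (countB-joins G a C) (commonCount (λ w → ∧-absorbˡ (adj G a w) (adj G b w))))
                   (trans (countB-joins G b C) (commonCount (λ w → ∧-absorbʳ (adj G a w) (adj G b w)))) ⟩
        l + l
      ∎
      where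
      open ≡-Reasoning
      C : Fin n → Bool
      C = isCommonNbr G a b
      commonCount : ∀ {v} → (∀ w → adj G v w ∧ C w ≡ C w) →
                    countB (λ w → adj G v w ∧ C w) (vertices n) ≡ l
      commonCount absorb =
        trans (countB-cong _ C (vertices n) (λ w _ → absorb w)) (proj₂ er a b (to (T-≡ {adj G a b}) ab))

    gallai-degree : countB (gallaiAdj G (a , b)) (edges G) ≡ ((k ∸ 1) + (k ∸ 1)) ∸ (l + l)
    gallai-degree = begin
        Γ
      ≡⟨ m+n∸n≡m Γ Δ ⟨
        Γ + Δ ∸ Δ
      ≡⟨ cong₂ _∸_ (trans (countB-+ _ _ _ (edges G) Γ+Δ≡L) lineGraph-degree) antiGallai-degree ⟩
        ((k ∸ 1) + (k ∸ 1)) ∸ (l + l)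
      ∎
      where
      open ≡-Reasoning
      Γ Δ : ℕ
      Γ = countB (gallaiAdj G (a , b)) (edges G)
      Δ = countB (antiGallaiAdj G (a , b)) (edges G)
      Γ+Δ≡L : ∀ f → f ∈ edges G →
              ⟦ gallaiAdj G (a , b) f ⟧ + ⟦ antiGallaiAdj G (a , b) f ⟧ ≡ ⟦ lineGraphAdj G (a , b) f ⟧
      Γ+Δ≡L (c , d) f∈ =
        ⟦∧⟧-split (not (sameEdge G (a , b) (c , d))) (shareVertex G (a , b) (c , d))
                  (commonTriangle G (a , b) (c , d))
          (proj₂ ∘ to (T-∧ {not (sameEdge G (a , b) (c , d))}) ∘ antiGallai⇒lineGraph G a<b ab (∈-edges⇒< G f∈))

theorem1 : (n k l : ℕ) (G : Graph n) → EdgeRegular G k l →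
           GallaiGraphRegular G × AntiGallaiGraphRegular G
theorem1 n k l G er =
    (_ , λ _ e∈ → uncurry (gallai-degree G er) (∈-edges⁻ G e∈))
  , (_ , λ _ e∈ → uncurry (antiGallai-degree G er) (∈-edges⁻ G e∈))
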